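{- The shuffle-group $1+X\mathbb K[[X]]$ is not isomorphic to the multiplicative group structure on $1+X\mathbb K[[X]]$ if $\mathbb K$ is of positive characteristic.
   Context: For a commutative field $\mathbb K$, the shuffle product on $\mathbb K[[X]]$ is $A\sqcup\!\sqcup B=\sum_{n,m\geq 0}\binom{n+m}{n}\alpha_n\beta_mX^{n+m}$ for $A=\sum_n\alpha_nX^n$, $B=\sum_n\beta_nX^n$. The shuffle-group $1+X\mathbb K[[X]]$ is this set with the group law $\sqcup\!\sqcup$; the multiplicative group structure is given by the ordinary (Cauchy) product of power series. -}

module Defs where

open import Level using (Level; _⊔_)
open import Data.Nat using (ℕ; zero; suc; _∸_)
open import Data.Nat.Combinatorics using (_C_)
open import Data.Product using (Σ; ∃; _×_; _,_; proj₁)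
open import Relation.Nullary using (¬_)
open import Algebra.Bundles using (CommutativeRing)

module _ {c ℓ : Level} (R : CommutativeRing c ℓ) where
  open CommutativeRing R

  IsField : Set (c ⊔ ℓ)
  IsField = (¬ (1# ≈ 0#)) × (∀ x → ¬ (x ≈ 0#) → Σ Carrier λ y → x * y ≈ 1#)

  infixr 8 _·_
  _·_ : ℕ → Carrier → Carrier
  zero · x = 0#
  suc n · x = x + n · x

  PositiveCharacteristic : Set ℓ
  PositiveCharacteristic = ∃ λ n → (suc n · 1#) ≈ 0#

  Series : Set c
  Series = ℕ → Carrier

  sumTo : ℕ → (ℕ → Carrier) → Carrier
  sumTo zero f = f 0
  sumTo (suc n) f = sumTo n f + f (suc n)

  cauchy : Series → Series → Series
  cauchy A B n = sumTo n λ k → A k * B (n ∸ k)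

  shuffle : Series → Series → Series
  shuffle A B n = sumTo n λ k → (n C k) · (A k * B (n ∸ k))

  OnePlusXK : Set (c ⊔ ℓ)
  OnePlusXK = Σ Series λ A → A 0 ≈ 1#

  _≋_ : OnePlusXK → OnePlusXK → Set ℓ
  A ≋ B = ∀ n → proj₁ A n ≈ proj₁ B n

  -- (The homomorphism condition is phrased with AB any element equal to
  -- A ш B, avoiding an explicit closure proof for the product.)
  -- The shuffle-group 1 + X K[[X]] is isomorphic to the multiplicative
  -- group 1 + X K[[X]]: there is a well-defined bijection f (w.r.t.
  -- coefficientwise equality) with f (A ш B) = f A · f B.
  ShuffleIsoMultiplicative : Set (c ⊔ ℓ)
  ShuffleIsoMultiplicative =
    Σ (OnePlusXK → OnePlusXK) λ f →
      (∀ A B → A ≋ B → f A ≋ f B) ×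
      (∀ A B → f A ≋ f B → A ≋ B) ×
      (∀ B → Σ OnePlusXK λ A → f A ≋ B) ×
      (∀ A B AB → (∀ n → proj₁ AB n ≈ shuffle (proj₁ A) (proj₁ B) n) →
         ∀ n → proj₁ (f AB) n ≈ cauchy (proj₁ (f A)) (proj₁ (f B)) n)

{-# OPTIONS --safe #-}
module Submission where

open import Defs
open import Level using (Level; _⊔_)
open import Relation.Nullary using (¬_)
open import Algebra.Bundles using (CommutativeRing)
open import Data.Nat using (ℕ; zero; suc; _∸_; _<_; _≤_; z≤n; s≤s)
open import Data.Nat.Properties using (≤-refl; m≤n⇒m≤1+n; n<1+n; n∸n≡0; m+n∸n≡m; +-∸-assoc)
open import Data.Nat.Induction using (<-rec)
open import Data.Nat.Combinatorics using (_C_; nCk+nC[k+1]≡[n+1]C[k+1]; k>n⇒nCk≡0)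
open import Data.Product using (Σ; _,_; proj₁; proj₂)
import Relation.Binary.PropositionalEquality as ≡

-- The shift ∂A (n) = A (n + 1) is a derivation of the shuffle product, so
-- ∂(A^ш(p+1)) = (p+1) · A^шp ш ∂A. If (p+1) · 1 = 0, every A with A 0 = 1
-- therefore satisfies A^ш(p+1) = 1: the shuffle group has finite exponent.
-- In the multiplicative group (1 + X)^k is monic of degree k, so 1 + X has
-- infinite order and is not the image of any element under a homomorphism.

module _ {c ℓ : Level} (K : CommutativeRing c ℓ) where
  open CommutativeRing K
  open import Algebra.Properties.Semiring.Mult semiring using (_×_; ×-congʳ; ×-congˡ; ×-homo-+; ×-comm-*)
  open import Algebra.Properties.CommutativeMonoid.Mult +-commutativeMonoid using (×-distrib-+)
  open import Algebra.Properties.CommutativeSemigroup +-commutativeSemigroup using (interchange; x∙yz≈y∙xz; xy∙z≈xz∙y)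
  open import Algebra.Properties.Group +-group using (identityˡ-unique)
  open import Relation.Binary.Reasoning.Setoid setoid

  ·≈× : ∀ n x → _·_ K n x ≈ n × x
  ·≈× zero x = refl
  ·≈× (suc n) x = +-congˡ (·≈× n x)

  ∑ : ℕ → (ℕ → Carrier) → Carrier
  ∑ = sumTo K

  ∑-cong : ∀ n {f g : ℕ → Carrier} → (∀ k → k ≤ n → f k ≈ g k) → ∑ n f ≈ ∑ n g
  ∑-cong zero f≈g = f≈g 0 z≤n
  ∑-cong (suc n) f≈g = +-cong (∑-cong n λ k k≤n → f≈g k (m≤n⇒m≤1+n k≤n)) (f≈g (suc n) ≤-refl)

  ∑-zero : ∀ n {f : ℕ → Carrier} → (∀ k → k ≤ n → f k ≈ 0#) → ∑ n f ≈ 0#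
  ∑-zero n f≈0 = trans (∑-cong n f≈0) (∑-const n)
    where
    ∑-const : ∀ n → ∑ n (λ _ → 0#) ≈ 0#
    ∑-const zero = refl
    ∑-const (suc n) = trans (+-identityʳ _) (∑-const n)

  ∑-distrib-+ : ∀ n (f g : ℕ → Carrier) → ∑ n (λ k → f k + g k) ≈ ∑ n f + ∑ n g
  ∑-distrib-+ zero f g = refl
  ∑-distrib-+ (suc n) f g = trans (+-congʳ (∑-distrib-+ n f g)) (interchange _ _ _ _)

  *-distribˡ-∑ : ∀ n a (f : ℕ → Carrier) → a * ∑ n f ≈ ∑ n (λ k → a * f k)
  *-distribˡ-∑ zero a f = refl
  *-distribˡ-∑ (suc n) a f = trans (distribˡ a _ _) (+-congʳ (*-distribˡ-∑ n a f))

  ∑-suc : ∀ n (f : ℕ → Carrier) → ∑ (suc n) f ≈ f 0 + ∑ n (λ k → f (suc k))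
  ∑-suc zero f = refl
  ∑-suc (suc n) f = trans (+-congʳ (∑-suc n f)) (+-assoc _ _ _)

  ∑-head : ∀ n {f : ℕ → Carrier} → (∀ k → k < n → f (suc k) ≈ 0#) → ∑ n f ≈ f 0
  ∑-head zero _ = refl
  ∑-head (suc n) f≈0 =
    trans (+-cong (∑-head n λ k k<n → f≈0 k (m≤n⇒m≤1+n k<n)) (f≈0 n ≤-refl)) (+-identityʳ _)

  ∑-last : ∀ n {f : ℕ → Carrier} → (∀ k → k < n → f k ≈ 0#) → ∑ n f ≈ f n
  ∑-last zero _ = refl
  ∑-last (suc n) f≈0 = trans (+-congʳ (∑-zero n λ k k≤n → f≈0 k (s≤s k≤n))) (+-identityˡ _)

  ∑-unshift : ∀ n {v w : ℕ → Carrier} → (∀ k → k < n → v k ≈ w (suc k)) → v n ≈ 0# →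
              w 0 + ∑ n v ≈ ∑ n w
  ∑-unshift zero _ v₀≈0 = trans (+-congˡ v₀≈0) (+-identityʳ _)
  ∑-unshift (suc n) {v} {w} v≈w vₙ≈0 = begin
    w 0 + (∑ n v + v (suc n))          ≈⟨ +-congˡ (trans (+-congˡ vₙ≈0) (+-identityʳ _)) ⟩
    w 0 + ∑ n v                        ≈⟨ +-congˡ (∑-cong n λ k k≤n → v≈w k (s≤s k≤n)) ⟩
    w 0 + ∑ n (λ k → w (suc k))        ≈⟨ ∑-suc n w ⟨
    ∑ (suc n) w                        ∎

  infix 4 _≐_
  _≐_ : Series K → Series K → Set ℓ
  A ≐ B = ∀ n → A n ≈ B n

  infixl 6 _⊕_
  _⊕_ : Series K → Series K → Series K
  (A ⊕ B) n = A n + B n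

  infixr 7 _⊙_
  _⊙_ : Carrier → Series K → Series K
  (a ⊙ A) n = a * A n

  𝟘 𝟙 : Series K
  𝟘 _ = 0#
  𝟙 zero = 1#
  𝟙 (suc _) = 0#

  ∂ : Series K → Series K
  ∂ A n = A (suc n)

  infixl 7 _ш_
  _ш_ : Series K → Series K → Series K
  (A ш B) n = ∑ n λ k → (n C k) × (A k * B (n ∸ k))

  shuffle≐ш : ∀ A B → shuffle K A B ≐ A ш B
  shuffle≐ш A B n = ∑-cong n λ k _ → ·≈× (n C k) _

  ш-congʳ : ∀ {A A′} → A ≐ A′ → ∀ B → A ш B ≐ A′ ш B
  ш-congʳ A≐A′ B n = ∑-cong n λ k _ → ×-congʳ (n C k) (*-congʳ (A≐A′ k))

  ш-coeff₀ : ∀ A B → (A ш B) 0 ≈ A 0 * B 0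
  ш-coeff₀ A B = +-identityʳ _

  ш-distribʳ-⊕ : ∀ A B Z → (A ⊕ B) ш Z ≐ A ш Z ⊕ B ш Z
  ш-distribʳ-⊕ A B Z n = trans
    (∑-cong n λ k _ → trans (×-congʳ (n C k) (distribʳ _ _ _)) (×-distrib-+ _ _ (n C k)))
    (∑-distrib-+ n _ _)

  ⊙-ш-assoc : ∀ a A B → (a ⊙ A) ш B ≐ a ⊙ (A ш B)
  ⊙-ш-assoc a A B n = trans
    (∑-cong n λ k _ → trans (×-congʳ (n C k) (*-assoc _ _ _)) (sym (×-comm-* (n C k) a _)))
    (sym (*-distribˡ-∑ n a _))

  ш-zeroˡ : ∀ B → 𝟘 ш B ≐ 𝟘
  ш-zeroˡ B n = ∑-zero n λ k _ → trans (sym (×-comm-* (n C k) 0# _)) (zeroˡ _)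

  -- Pascal's rule splits the (n+1)-st coefficient into two shuffles; the
  -- second one is (A ш ∂B) n with its summation index shifted by one.
  ∂-ш : ∀ A B → ∂ (A ш B) ≐ ∂ A ш B ⊕ A ш ∂ B
  ∂-ш A B n = begin
    ∑ (suc n) g                            ≈⟨ ∑-suc n g ⟩
    g 0 + ∑ n (λ k → g (suc k))            ≈⟨ +-congˡ (∑-cong n λ k _ → pascal k) ⟩
    g 0 + ∑ n (λ k → u k + v k)            ≈⟨ +-congˡ (∑-distrib-+ n u v) ⟩
    g 0 + (∑ n u + ∑ n v)                  ≈⟨ x∙yz≈y∙xz _ _ _ ⟩
    ∑ n u + (g 0 + ∑ n v)                  ≈⟨ +-congˡ (∑-unshift n shift (×-congˡ (k>n⇒nCk≡0 (n<1+n n)))) ⟩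
    (∂ A ш B) n + (A ш ∂ B) n              ∎
    where
    t u v : ℕ → Carrier
    t k = A (suc k) * B (n ∸ k)
    u k = (n C k) × t k
    v k = (n C suc k) × t k
    g : ℕ → Carrier
    g k = (suc n C k) × (A k * B (suc n ∸ k))
    pascal : ∀ k → g (suc k) ≈ u k + v k
    pascal k = trans (×-congˡ (≡.sym (nCk+nC[k+1]≡[n+1]C[k+1] n k))) (×-homo-+ (t k) (n C k) (n C suc k))
    shift : ∀ k → k < n → v k ≈ (n C suc k) × (A (suc k) * B (suc (n ∸ suc k)))
    shift k k<n = ×-congʳ (n C suc k) (*-congˡ (reflexive (≡.cong B (+-∸-assoc 1 k<n))))

  ш-identityˡ : ∀ B → 𝟙 ш B ≐ B
  ш-identityˡ B zero = trans (ш-coeff₀ 𝟙 B) (*-identityˡ _)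
  ш-identityˡ B (suc n) = begin
    ∂ (𝟙 ш B) n                ≈⟨ ∂-ш 𝟙 B n ⟩
    (∂ 𝟙 ш B) n + (𝟙 ш ∂ B) n  ≈⟨ +-cong (ш-zeroˡ B n) (ш-identityˡ (∂ B) n) ⟩
    0# + ∂ B n                 ≈⟨ +-identityˡ _ ⟩
    B (suc n)                  ∎

  ш-rcomm : ∀ A B Z → (A ш B) ш Z ≐ (A ш Z) ш B
  ш-rcomm A B Z zero = begin
    ((A ш B) ш Z) 0  ≈⟨ trans (ш-coeff₀ (A ш B) Z) (*-congʳ (ш-coeff₀ A B)) ⟩
    A 0 * B 0 * Z 0  ≈⟨ trans (*-assoc _ _ _) (trans (*-congˡ (*-comm _ _)) (sym (*-assoc _ _ _))) ⟩
    A 0 * Z 0 * B 0  ≈⟨ sym (trans (ш-coeff₀ (A ш Z) B) (*-congʳ (ш-coeff₀ A Z))) ⟩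
    ((A ш Z) ш B) 0  ∎
  ш-rcomm A B Z (suc n) = begin
    ∂ ((A ш B) ш Z) n                                        ≈⟨ ∂-шш A B Z n ⟩
    ((∂ A ш B) ш Z) n + ((A ш ∂ B) ш Z) n + ((A ш B) ш ∂ Z) n
      ≈⟨ +-cong (+-cong (ш-rcomm (∂ A) B Z n) (ш-rcomm A (∂ B) Z n)) (ш-rcomm A B (∂ Z) n) ⟩
    ((∂ A ш Z) ш B) n + ((A ш Z) ш ∂ B) n + ((A ш ∂ Z) ш B) n ≈⟨ xy∙z≈xz∙y _ _ _ ⟩
    ((∂ A ш Z) ш B) n + ((A ш ∂ Z) ш B) n + ((A ш Z) ш ∂ B) n ≈⟨ ∂-шш A Z B n ⟨
    ∂ ((A ш Z) ш B) n                                        ∎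
    where
    ∂-шш : ∀ A B Z → ∂ ((A ш B) ш Z) ≐ (∂ A ш B) ш Z ⊕ (A ш ∂ B) ш Z ⊕ (A ш B) ш ∂ Z
    ∂-шш A B Z n = trans (∂-ш (A ш B) Z n)
      (+-congʳ (trans (ш-congʳ (∂-ш A B) Z n) (ш-distribʳ-⊕ _ _ Z n)))

  infixr 8 _^ш_
  _^ш_ : Series K → ℕ → Series K
  A ^ш zero = 𝟙
  A ^ш suc k = A ^ш k ш A

  ^ш-coeff₀ : ∀ {A} → A 0 ≈ 1# → ∀ k → (A ^ш k) 0 ≈ 1#
  ^ш-coeff₀ A₀≈1 zero = refl
  ^ш-coeff₀ {A} A₀≈1 (suc k) =
    trans (ш-coeff₀ (A ^ш k) A) (trans (*-cong (^ш-coeff₀ A₀≈1 k) A₀≈1) (*-identityˡ _))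

  ∂-^ш : ∀ A j → ∂ (A ^ш suc j) ≐ (suc j × 1#) ⊙ (A ^ш j ш ∂ A)
  ∂-^ш A zero n = begin
    ∂ (𝟙 ш A) n                ≈⟨ ∂-ш 𝟙 A n ⟩
    (∂ 𝟙 ш A) n + (𝟙 ш ∂ A) n  ≈⟨ trans (+-congʳ (ш-zeroˡ A n)) (+-identityˡ _) ⟩
    (𝟙 ш ∂ A) n                ≈⟨ trans (*-congʳ (+-identityʳ 1#)) (*-identityˡ _) ⟨
    (1# + 0#) * (𝟙 ш ∂ A) n    ∎
  ∂-^ш A (suc j) n = begin
    ∂ (A ^ш suc j ш A) n                      ≈⟨ ∂-ш (A ^ш suc j) A n ⟩
    (∂ (A ^ш suc j) ш A) n + x                ≈⟨ +-congʳ (ш-congʳ (∂-^ш A j) A n) ⟩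
    ((m ⊙ (A ^ш j ш ∂ A)) ш A) n + x          ≈⟨ +-congʳ (⊙-ш-assoc m _ A n) ⟩
    m * ((A ^ш j ш ∂ A) ш A) n + x            ≈⟨ +-congʳ (*-congˡ (ш-rcomm (A ^ш j) (∂ A) A n)) ⟩
    m * x + x                                 ≈⟨ +-comm _ _ ⟩
    x + m * x                                 ≈⟨ +-congʳ (*-identityˡ x) ⟨
    1# * x + m * x                            ≈⟨ distribʳ x 1# m ⟨
    (1# + m) * x                              ∎
    where
    m = suc j × 1#
    x = (A ^ш suc j ш ∂ A) n

  ^ш-char : ∀ {A} p → suc p × 1# ≈ 0# → A 0 ≈ 1# → A ^ш suc p ≐ 𝟙
  ^ш-char p char A₀≈1 zero = ^ш-coeff₀ A₀≈1 (suc p)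
  ^ш-char {A} p char A₀≈1 (suc n) =
    trans (∂-^ш A p n) (trans (*-congʳ char) (zeroˡ _))

  cauchy-congˡ : ∀ A {B B′} → B ≐ B′ → cauchy K A B ≐ cauchy K A B′
  cauchy-congˡ A B≐B′ n = ∑-cong n λ k _ → *-congˡ (B≐B′ (n ∸ k))

  cauchy-idem⇒𝟙 : ∀ F → F 0 ≈ 1# → F ≐ cauchy K F F → F ≐ 𝟙
  cauchy-idem⇒𝟙 F F₀≈1 idem zero = F₀≈1
  cauchy-idem⇒𝟙 F F₀≈1 idem (suc n) = <-rec (λ n → F (suc n) ≈ 0#) step n
    where
    step : ∀ n → (∀ {j} → j < n → F (suc j) ≈ 0#) → F (suc n) ≈ 0#
    step n ih = identityˡ-unique x x (sym (begin
      x                    ≈⟨ idem (suc n) ⟩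
      ∑ n t + t (suc n)    ≈⟨ +-cong (∑-head n λ k k<n → trans (*-congʳ (ih k<n)) (zeroˡ _))
                                     (*-congˡ (reflexive (≡.cong F (n∸n≡0 n)))) ⟩
      F 0 * x + x * F 0    ≈⟨ +-cong (trans (*-congʳ F₀≈1) (*-identityˡ x))
                                     (trans (*-congˡ F₀≈1) (*-identityʳ x)) ⟩
      x + x                ∎))
      where
      x = F (suc n)
      t : ℕ → Carrier
      t k = F k * F (suc n ∸ k)

  1+X : Series K
  1+X zero = 1#
  1+X (suc zero) = 1#
  1+X (suc (suc _)) = 0#

  1+X-vanishes : ∀ {k n} → k < n → 1+X (suc n ∸ k) ≈ 0#
  1+X-vanishes {zero} {suc n} _ = refl
  1+X-vanishes {suc k} {suc n} (s≤s k<n) = 1+X-vanishes k<n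

  cauchy-1+X : ∀ B n → cauchy K B 1+X (suc n) ≈ B n + B (suc n)
  cauchy-1+X B n = +-cong
    (trans (∑-last n λ k k<n → trans (*-congˡ (1+X-vanishes k<n)) (zeroʳ _))
           (trans (*-congˡ (reflexive (≡.cong 1+X (m+n∸n≡m 1 n)))) (*-identityʳ _)))
    (trans (*-congˡ (reflexive (≡.cong 1+X (n∸n≡0 n)))) (*-identityʳ _))

  record Monic (d : ℕ) (B : Series K) : Set ℓ where
    field
      leading : B d ≈ 1#
      beyond : ∀ {j} → d < j → B j ≈ 0#

  Monic-resp : ∀ {d B B′} → B ≐ B′ → Monic d B → Monic d B′
  Monic-resp B≐B′ B-monic = record
    { leading = trans (sym (B≐B′ _)) (Monic.leading B-monic)
    ; beyond = λ d<j → trans (sym (B≐B′ _)) (Monic.beyond B-monic d<j)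
    }

  𝟙-monic : Monic 0 𝟙
  𝟙-monic = record { leading = refl ; beyond = λ { {suc j} _ → refl } }

  monic-*1+X : ∀ {d B} → Monic d B → Monic (suc d) (cauchy K B 1+X)
  monic-*1+X {d} {B} B-monic = record
    { leading = trans (cauchy-1+X B d) (trans (+-cong leading (beyond ≤-refl)) (+-identityʳ 1#))
    ; beyond = λ { {suc j} (s≤s d<j) → trans (cauchy-1+X B j)
                     (trans (+-cong (beyond d<j) (beyond (m≤n⇒m≤1+n d<j))) (+-identityʳ 0#)) }
    }
    where open Monic B-monic

  𝟙⁺ 1+X⁺ : OnePlusXK K
  𝟙⁺ = 𝟙 , refl
  1+X⁺ = 1+X , refl

  infixr 8 _^ш⁺_
  _^ш⁺_ : OnePlusXK K → ℕ → OnePlusXK K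
  A ^ш⁺ k = proj₁ A ^ш k , ^ш-coeff₀ (proj₂ A) k

  IsShuffleToCauchyHom : (OnePlusXK K → OnePlusXK K) → Set (c ⊔ ℓ)
  IsShuffleToCauchyHom f = ∀ A B AB → (∀ n → proj₁ AB n ≈ shuffle K (proj₁ A) (proj₁ B) n) →
                           ∀ n → proj₁ (f AB) n ≈ cauchy K (proj₁ (f A)) (proj₁ (f B)) n

  module ShuffleToCauchyHom (f : OnePlusXK K → OnePlusXK K) (f-hom : IsShuffleToCauchyHom f) where

    f-𝟙 : proj₁ (f 𝟙⁺) ≐ 𝟙
    f-𝟙 = cauchy-idem⇒𝟙 (proj₁ (f 𝟙⁺)) (proj₂ (f 𝟙⁺))
            (f-hom 𝟙⁺ 𝟙⁺ 𝟙⁺ λ n → sym (trans (shuffle≐ш 𝟙 𝟙 n) (ш-identityˡ 𝟙 n)))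

    f-^ш-monic : ∀ A → proj₁ (f A) ≐ 1+X → ∀ k → Monic k (proj₁ (f (A ^ш⁺ k)))
    f-^ш-monic A fA≐1+X zero = Monic-resp (λ n → sym (f-𝟙 n)) 𝟙-monic
    f-^ш-monic A fA≐1+X (suc k) = Monic-resp (λ n → sym (f-^ш-suc n)) (monic-*1+X (f-^ш-monic A fA≐1+X k))
      where
      f-^ш-suc : proj₁ (f (A ^ш⁺ suc k)) ≐ cauchy K (proj₁ (f (A ^ш⁺ k))) 1+X
      f-^ш-suc n = trans (f-hom (A ^ш⁺ k) A (A ^ш⁺ suc k) (λ n → sym (shuffle≐ш _ (proj₁ A) n)) n)
                         (cauchy-congˡ _ fA≐1+X n)

  no-shuffle-epimorphism : ¬ 1# ≈ 0# → PositiveCharacteristic K →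
    ∀ f → (∀ A B → _≋_ K A B → _≋_ K (f A) (f B)) → (∀ B → Σ (OnePlusXK K) λ A → _≋_ K (f A) B) →
    ¬ IsShuffleToCauchyHom f
  no-shuffle-epimorphism 1≉0 (p , p·1≈0) f f-cong f-surj f-hom = 1≉0 (begin
    1#                       ≈⟨ Monic.leading (f-^ш-monic A fA≐1+X (suc p)) ⟨
    proj₁ (f (A ^ш⁺ suc p)) (suc p)
      ≈⟨ f-cong (A ^ш⁺ suc p) 𝟙⁺ (^ш-char p (trans (sym (·≈× (suc p) 1#)) p·1≈0) (proj₂ A)) (suc p) ⟩
    proj₁ (f 𝟙⁺) (suc p)     ≈⟨ f-𝟙 (suc p) ⟩
    0#                       ∎)
    where
    open ShuffleToCauchyHom f f-hom
    A = proj₁ (f-surj 1+X⁺)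
    fA≐1+X = proj₂ (f-surj 1+X⁺)

corollary3p4 : {c ℓ : Level} (K : CommutativeRing c ℓ) →
    IsField K → PositiveCharacteristic K → ¬ ShuffleIsoMultiplicative K
corollary3p4 K (1≉0 , _) char (f , f-cong , _ , f-surj , f-hom) =
  no-shuffle-epimorphism K 1≉0 char f f-cong f-surj f-hom
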